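{- For $n>0$, the map $\tilde\sigma$ is an isomorphism from $\mathbf{Bub}(n-1,1)$ to $\mathbf{Hoch}(n)$.
   Context: Let $X=\{x_1,\ldots,x_m\}$ and $Y=\{y_1,\ldots,y_n\}$ be disjoint alphabets, and write $\mathbf{x}=x_1x_2\cdots x_m$ and $\mathbf{y}=y_1y_2\cdots y_n$. A shuffle word is a word $\mathbf{w}$ over $X\cup Y$ without repeated letters such that its restriction $\mathbf{w}_{\mathbf{x}}$ to the letters of $X$ is a subword of $\mathbf{x}$ and its restriction $\mathbf{w}_{\mathbf{y}}$ to the letters of $Y$ is a subword of $\mathbf{y}$; $\mathsf{Shuf}(m,n)$ is the set of all shuffle words. For $\mathbf{u}=u_1\cdots u_k$, an indel either deletes a letter of $X$ from $\mathbf{u}$ or inserts a letter of $Y$ into $\mathbf{u}$ (producing a shuffle word), and a transposition replaces a consecutive pair $u_iu_{i+1}$ with $u_i\in X$, $u_{i+1}\in Y$ by $u_{i+1}u_i$. The bubble order $\leq_{\mathsf{bub}}$ is the reflexive and transitive closure of indels and transpositions, and $\mathbf{Bub}(m,n)=(\mathsf{Shuf}(m,n),\leq_{\mathsf{bub}})$. A triword of length $n$ is an integer tuple $(u_1,\ldots,u_n)$ with $u_i\in\{0,1,2\}$ for all $i$, $u_1\neq 2$, and such that $u_i=0$ implies $u_j\neq 1$ for all $j>i$. Let $\mathsf{Tri}(n)$ be the set of triwords of length $n$, and let $\mathbf{Hoch}(n)=(\mathsf{Tri}(n),\leq_{\mathsf{comp}})$ be the Hochschild lattice, where $\leq_{\mathsf{comp}}$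 is the componentwise order. The map $\tilde\sigma\colon\mathsf{Shuf}(n-1,1)\to\mathbb{Z}^n$ sends a shuffle word $\mathbf{u}$ (over $X=\{x_1,\ldots,x_{n-1}\}$, $Y=\{y_1\}$) to $(u_1,\ldots,u_n)$ defined as follows: if $x_s$ is not a letter of $\mathbf{u}$, then $u_{n+1-s}=2$; if $y_1$ appears immediately after $x_s$ in $\mathbf{u}$ (interpreted as $s=0$ if $y_1$ is the first letter), then $u_i=1$ for all $i\in\{1,\ldots,n-s\}$ with $u_i\neq 2$; all remaining entries are $0$. For example, for $\mathbf{u}=x_2x_4x_5y_1x_8\in\mathsf{Shuf}(8,1)$ one gets $\tilde\sigma(\mathbf{u})=(1,1,2,2,0,0,2,0,2)$. -}

module Defs where

open import Data.Nat using (ℕ; zero; suc; _≤_; _<_; _∸_)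
open import Data.Fin as Fin using (Fin; toℕ; opposite)
open import Data.Bool using (Bool; true; false; if_then_else_)
open import Data.Maybe using (Maybe; just; nothing)
open import Data.List using (List; []; _∷_; _++_)
open import Data.List.Relation.Unary.Unique.Propositional using (Unique)
open import Data.List.Relation.Unary.Linked using (Linked)
open import Data.Product using (Σ; _×_; proj₁)
open import Relation.Binary.PropositionalEquality using (_≡_; _≢_)
open import Relation.Nullary using (yes; no)
open import Relation.Binary.Construct.Closure.ReflexiveTransitive using (Star)

-- Shuffle words over X = {x_1..x_m}, Y = {y_1..y_n}.
-- Letter X j stands for x_{toℕ j + 1}, Y j for y_{toℕ j + 1}.

data Letter (m n : ℕ) : Set where
  X : Fin m → Letter m n
  Y : Fin n → Letter m n

restrX : ∀ {m n} → List (Letter m n) → List (Fin m)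
restrX [] = []
restrX (X i ∷ w) = i ∷ restrX w
restrX (Y _ ∷ w) = restrX w

restrY : ∀ {m n} → List (Letter m n) → List (Fin n)
restrY [] = []
restrY (X _ ∷ w) = restrY w
restrY (Y j ∷ w) = j ∷ restrY w

-- no repeated letters, w_x a subword of x_1...x_m, w_y a subword of y_1...y_n
-- (a repetition-free subword of x_1...x_m = strictly increasing index list)
IsShuf : ∀ {m n} → List (Letter m n) → Set
IsShuf w = Unique w × Linked Fin._<_ (restrX w) × Linked Fin._<_ (restrY w)

Shuf : ℕ → ℕ → Set
Shuf m n = Σ (List (Letter m n)) IsShuf

data Step {m n : ℕ} : List (Letter m n) → List (Letter m n) → Set where
  delete : ∀ a b (i : Fin m) → IsShuf (a ++ X i ∷ b) →
           Step (a ++ X i ∷ b) (a ++ b)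
  insert : ∀ a b (j : Fin n) → IsShuf (a ++ b) → IsShuf (a ++ Y j ∷ b) →
           Step (a ++ b) (a ++ Y j ∷ b)
  transpose : ∀ a b (i : Fin m) (j : Fin n) → IsShuf (a ++ X i ∷ Y j ∷ b) →
           Step (a ++ X i ∷ Y j ∷ b) (a ++ Y j ∷ X i ∷ b)

_≤bub_ : ∀ {m n} → Shuf m n → Shuf m n → Set
u ≤bub v = Star Step (proj₁ u) (proj₁ v)

-- Triwords of length n, as functions Fin n → ℕ (position i ↔ index toℕ i + 1)

IsTri : ∀ {n} → (Fin n → ℕ) → Set
IsTri {n} u =
  (∀ i → u i ≤ 2) ×
  (∀ i → toℕ i ≡ 0 → u i ≢ 2) ×
  (∀ i j → i Fin.< j → u i ≡ 0 → u j ≢ 1)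

Tri : ℕ → Set
Tri n = Σ (Fin n → ℕ) IsTri

_≤comp_ : ∀ {n} → (Fin n → ℕ) → (Fin n → ℕ) → Set
u ≤comp v = ∀ i → u i ≤ v i

-- The map σ̃ : Shuf(k,1) → ℤ^(k+1)  (n = k + 1), with values in ℕ.

memX : ∀ {m n} → Fin m → List (Letter m n) → Bool
memX j [] = false
memX j (Y _ ∷ w) = memX j w
memX j (X i ∷ w) with i Fin.≟ j
... | yes _ = true
... | no _ = memX j w

-- s such that y_1 appears immediately after x_s (s = 0 if y_1 is first);
-- nothing if y_1 does not occur.  First argument: index of previous x.
ySlot : ∀ {m n} → ℕ → List (Letter m n) → Maybe ℕ
ySlot prev [] = nothing
ySlot prev (Y _ ∷ w) = just prev
ySlot prev (X i ∷ w) = ySlot (suc (toℕ i)) w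

-- position i (1-based index toℕ i + 1) corresponds to x_s with s = n + 1 - (toℕ i + 1);
-- position 0 corresponds to s = n, which is not a letter.
xAt : ∀ {k} → Fin (suc k) → Maybe (Fin k)
xAt Fin.zero = nothing
xAt (Fin.suc j) = just (opposite j)

missing : ∀ {k} → List (Letter k 1) → Fin (suc k) → Bool
missing w i with xAt i
... | nothing = false
... | just j = if memX j w then false else true

inYRange : ∀ {k} → List (Letter k 1) → Fin (suc k) → Bool
inYRange {k} w i with ySlot 0 w
... | nothing = false
... | just s with suc (toℕ i) Data.Nat.≤? (suc k ∸ s)
...   | yes _ = true
...   | no _ = false

σ̃ : ∀ {k} → List (Letter k 1) → Fin (suc k) → ℕ
σ̃ w i = if missing w i then 2 else (if inYRange w i then 1 else 0)

-- In a shuffle word of Shuf(k,1) the x's increase, so it is determined by whether y_1 occurs and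
-- by the status of each x_l: absent (2), after y_1 (1) or before y_1 (0). σ̃ records exactly this
-- data (first whether y_1 occurs, then the statuses of x_k, ..., x_1), and the triword conditions
-- say that every x before y_1 is smaller than every x after it, with none after y_1 if y_1 is
-- absent; this is what is needed to rebuild the word, so σ̃ is a bijection. Every indel or
-- transposition raises σ̃ componentwise. Conversely, if σ̃ u ≤ σ̃ v and u ≠ v, then one of three
-- steps (deleting a letter that v lacks, appending y_1, or swapping y_1 with the letter just
-- before it) stays below σ̃ v and strictly increases the sum of the entries; iterating reaches v.
module Submission where

open import Defs
open import Data.Nat as ℕ using (ℕ; zero; suc; _+_; _∸_; z≤n; s≤s)
import Data.Nat.Properties as ℕ
import Data.List.Properties as List
open import Data.Fin as Fin using (Fin; toℕ; opposite)
import Data.Fin.Properties as Fin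
open import Data.List as List using (List; []; _∷_; _++_)
open import Data.List.Relation.Unary.All as All using (All; []; _∷_)
import Data.List.Relation.Unary.All.Properties as All
open import Data.List.Relation.Unary.AllPairs as AllPairs using (AllPairs; []; _∷_)
import Data.List.Relation.Unary.AllPairs.Properties as AllPairs
open import Data.List.Relation.Unary.Linked.Properties using (AllPairs⇒Linked; Linked⇒AllPairs)
open import Data.Maybe using (just; nothing; is-just)
open import Data.Product using (Σ; _×_; _,_; proj₁; proj₂)
open import Data.Unit using (⊤; tt)
open import Data.Bool using (Bool; true; false; if_then_else_; _∨_)
open import Data.Bool.Properties using (∨-zeroʳ)
open import Relation.Binary.Definitions using (tri<; tri≈; tri>)
open import Relation.Nullary using (¬_; ¬?; yes; no; contradiction)
open import Relation.Nullary.Decidable using (_×-dec_)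
open import Data.Sum using (_⊎_; inj₁; inj₂)
open import Function using (_∘_)
open import Function.Bundles using (_⇔_; mk⇔; Equivalence)
open import Relation.Binary.PropositionalEquality
open import Relation.Binary.Construct.Closure.ReflexiveTransitive using (Star; ε; _◅_)

bit : Bool → ℕ
bit b = if b then 1 else 0

bit≤1 : ∀ b → bit b ℕ.≤ 1
bit≤1 true  = ℕ.≤-refl
bit≤1 false = z≤n

bit≢2 : ∀ b → bit b ≢ 2
bit≢2 true  ()
bit≢2 false ()

bit≤bit-true : ∀ a {b} → b ≡ true → bit a ℕ.≤ bit b
bit≤bit-true a refl = bit≤1 a

bit<bit : ∀ {a b} → a ≡ false → b ≡ true → bit a ℕ.< bit b
bit<bit refl refl = ℕ.≤-refl

bit≤bit⇒true : ∀ {a b} → bit a ℕ.≤ bit b → a ≡ true → b ≡ true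
bit≤bit⇒true {b = true}      _  _  = refl
bit≤bit⇒true {true} {false} () _

bit-injective : ∀ {a b} → bit a ≡ bit b → a ≡ b
bit-injective {true}  {true}  _ = refl
bit-injective {false} {false} _ = refl

bit[n≡ᵇ1]≡n : ∀ {n} → n ℕ.≤ 1 → bit (n ℕ.≡ᵇ 1) ≡ n
bit[n≡ᵇ1]≡n z≤n       = refl
bit[n≡ᵇ1]≡n (s≤s z≤n) = refl

[n≡ᵇ1]≡false⇒n≡0 : ∀ {n} → n ℕ.≤ 1 → (n ℕ.≡ᵇ 1) ≡ false → n ≡ 0
[n≡ᵇ1]≡false⇒n≡0 z≤n       _  = refl
[n≡ᵇ1]≡false⇒n≡0 (s≤s z≤n) ()

≤2⇒≢3+ : ∀ {n m} → n ℕ.≤ 2 → n ≢ 3 + m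
≤2⇒≢3+ (s≤s (s≤s ())) refl

m≤o∸n⇒n≤o∸m : ∀ {m n o} → n ℕ.≤ o → m ℕ.≤ o ∸ n → n ℕ.≤ o ∸ m
m≤o∸n⇒n≤o∸m {m} {n} {o} n≤o m≤o∸n =
  ℕ.m+n≤o⇒m≤o∸n n (subst (ℕ._≤ o) (ℕ.+-comm m n) (ℕ.m≤o∸n⇒m+n≤o m n≤o m≤o∸n))

opposite-< : ∀ {k} {i j : Fin k} → i Fin.< j → opposite j Fin.< opposite i
opposite-< {i = i} {j} i<j = subst₂ ℕ._<_ (sym (Fin.opposite-prop j)) (sym (Fin.opposite-prop i))
                                     (ℕ.∸-monoʳ-< (s≤s i<j) (Fin.toℕ<n j))

isTri-resp : ∀ {n} {f g : Fin n → ℕ} → (∀ i → f i ≡ g i) → IsTri f → IsTri g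
isTri-resp f≗g (≤2 , ≢2 , 0⇒≢1) =
  (λ i → subst (ℕ._≤ 2) (f≗g i) (≤2 i)) ,
  (λ i i≡0 → ≢2 i i≡0 ∘ trans (f≗g i)) ,
  (λ i j i<j gi≡0 → 0⇒≢1 i j i<j (trans (f≗g i) gi≡0) ∘ trans (f≗g j))

module _ {A : Set} {R : A → A → Set} where

  private
    All-delete : ∀ {P : A → Set} a {x c} → All P (a ++ x ∷ c) → All P (a ++ c)
    All-delete []      (_ ∷ ps) = ps
    All-delete (_ ∷ a) (p ∷ ps) = p ∷ All-delete a ps

    All-swap : ∀ {P : A → Set} a {x y c} → All P (a ++ x ∷ y ∷ c) → All P (a ++ y ∷ x ∷ c)
    All-swap []      (px ∷ py ∷ ps) = py ∷ px ∷ ps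
    All-swap (_ ∷ a) (p ∷ ps)       = p ∷ All-swap a ps

  AllPairs-delete : ∀ a {x c} → AllPairs R (a ++ x ∷ c) → AllPairs R (a ++ c)
  AllPairs-delete []      (_ ∷ ps) = ps
  AllPairs-delete (_ ∷ a) (p ∷ ps) = All-delete a p ∷ AllPairs-delete a ps

  AllPairs-swap : ∀ a {x y c} → R y x → AllPairs R (a ++ x ∷ y ∷ c) → AllPairs R (a ++ y ∷ x ∷ c)
  AllPairs-swap []      Ryx ((_ ∷ px) ∷ py ∷ ps) = (Ryx ∷ py) ∷ px ∷ ps
  AllPairs-swap (_ ∷ a) Ryx (p ∷ ps)             = All-swap a p ∷ AllPairs-swap a Ryx ps

total : ∀ {n} → (Fin n → ℕ) → ℕ
total {zero}  f = 0
total {suc n} f = f Fin.zero + total (f ∘ Fin.suc)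

total-mono : ∀ {n} {f g : Fin n → ℕ} → (∀ i → f i ℕ.≤ g i) → total f ℕ.≤ total g
total-mono {zero}  f≤g = z≤n
total-mono {suc n} f≤g = ℕ.+-mono-≤ (f≤g Fin.zero) (total-mono (f≤g ∘ Fin.suc))

total-mono-< : ∀ {n} {f g : Fin n → ℕ} → (∀ i → f i ℕ.≤ g i) →
               ∀ i → f i ℕ.< g i → total f ℕ.< total g
total-mono-< f≤g Fin.zero    f<g = ℕ.+-mono-<-≤ f<g (total-mono (f≤g ∘ Fin.suc))
total-mono-< f≤g (Fin.suc i) f<g = ℕ.+-mono-≤-< (f≤g Fin.zero) (total-mono-< (f≤g ∘ Fin.suc) i f<g)

≤2-squeeze : ∀ {x y} → x ℕ.≤ y → y ℕ.≤ 2 → ¬ (x ≢ 2 × y ≡ 2) → ¬ (x ≡ 0 × y ≡ 1) → x ≡ y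
≤2-squeeze {0}     {0}     _        _   _    _    = refl
≤2-squeeze {1}     {1}     _        _   _    _    = refl
≤2-squeeze {2}     {2}     _        _   _    _    = refl
≤2-squeeze {0}     {1}     _        _   _    ¬0,1 = contradiction (refl , refl) ¬0,1
≤2-squeeze {0}     {2}     _        _   ¬x,2 _    = contradiction ((λ ()) , refl) ¬x,2
≤2-squeeze {1}     {2}     _        _   ¬x,2 _    = contradiction ((λ ()) , refl) ¬x,2
≤2-squeeze {suc _} {0}     ()       _   _    _
≤2-squeeze {2}     {1}     (s≤s ()) _   _    _
≤2-squeeze {_} {suc (suc (suc _))} _   y≤2 _ _ = contradiction refl (≤2⇒≢3+ y≤2)
≤2-squeeze {suc (suc (suc _))} {_} x≤y y≤2 _ _ = contradiction refl (≤2⇒≢3+ (ℕ.≤-trans x≤y y≤2))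

module _ {m n : ℕ} where

  infix 4 _≺_
  _≺_ : Letter m n → Letter m n → Set
  X i ≺ X j = i Fin.< j
  X _ ≺ Y _ = ⊤
  Y _ ≺ X _ = ⊤
  Y i ≺ Y j = i Fin.< j

  Sorted : List (Letter m n) → Set
  Sorted = AllPairs _≺_

  ≺-irrefl : ∀ {a b} → a ≺ b → a ≢ b
  ≺-irrefl {X i} i<i refl = ℕ.<-irrefl refl i<i
  ≺-irrefl {Y j} j<j refl = ℕ.<-irrefl refl j<j

  private
    restrX-All⁺ : ∀ {i} w → All (X i ≺_) w → All (i Fin.<_) (restrX w)
    restrX-All⁺ []          []       = []
    restrX-All⁺ (X _ ∷ w) (p ∷ ps) = p ∷ restrX-All⁺ w ps
    restrX-All⁺ (Y _ ∷ w) (_ ∷ ps) = restrX-All⁺ w ps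

    restrX-All⁻ : ∀ {i} w → All (i Fin.<_) (restrX w) → All (X i ≺_) w
    restrX-All⁻ []        []       = []
    restrX-All⁻ (X _ ∷ w) (p ∷ ps) = p ∷ restrX-All⁻ w ps
    restrX-All⁻ (Y _ ∷ w) ps       = tt ∷ restrX-All⁻ w ps

    restrY-All⁺ : ∀ {j} w → All (Y j ≺_) w → All (j Fin.<_) (restrY w)
    restrY-All⁺ []        []       = []
    restrY-All⁺ (X _ ∷ w) (_ ∷ ps) = restrY-All⁺ w ps
    restrY-All⁺ (Y _ ∷ w) (p ∷ ps) = p ∷ restrY-All⁺ w ps

    restrY-All⁻ : ∀ {j} w → All (j Fin.<_) (restrY w) → All (Y j ≺_) w
    restrY-All⁻ []        []       = []
    restrY-All⁻ (X _ ∷ w) ps       = tt ∷ restrY-All⁻ w ps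
    restrY-All⁻ (Y _ ∷ w) (p ∷ ps) = p ∷ restrY-All⁻ w ps

    restr⁺ : ∀ w → Sorted w →
             AllPairs Fin._<_ (restrX w) × AllPairs Fin._<_ (restrY w)
    restr⁺ []        []       = [] , []
    restr⁺ (X _ ∷ w) (p ∷ ps) = let xs , ys = restr⁺ w ps in restrX-All⁺ w p ∷ xs , ys
    restr⁺ (Y _ ∷ w) (p ∷ ps) = let xs , ys = restr⁺ w ps in xs , restrY-All⁺ w p ∷ ys

    restr⁻ : ∀ w → AllPairs Fin._<_ (restrX w) → AllPairs Fin._<_ (restrY w) →
             Sorted w
    restr⁻ []        _        _        = []
    restr⁻ (X _ ∷ w) (p ∷ xs) ys       = restrX-All⁻ w p ∷ restr⁻ w xs ys
    restr⁻ (Y _ ∷ w) xs       (p ∷ ys) = restrY-All⁻ w p ∷ restr⁻ w xs ys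

  isShuf⇒sorted : ∀ {w} → IsShuf w → Sorted w
  isShuf⇒sorted {w} (_ , xs , ys) =
    restr⁻ w (Linked⇒AllPairs Fin.<-trans xs) (Linked⇒AllPairs Fin.<-trans ys)

  sorted⇒isShuf : ∀ {w} → Sorted w → IsShuf w
  sorted⇒isShuf {w} ps = let xs , ys = restr⁺ w ps in
    AllPairs.map ≺-irrefl ps , AllPairs⇒Linked xs , AllPairs⇒Linked ys

Word : ℕ → Set
Word k = List (Letter k 1)

module _ {k : ℕ} where

  hasY : Word k → Bool
  hasY []        = false
  hasY (X _ ∷ w) = hasY w
  hasY (Y _ ∷ w) = true

  -- The flag records whether y has already been read.
  status : Bool → Word k → Fin k → ℕ
  status b []        l = 2
  status b (Y _ ∷ w) l = status true w l
  status b (X i ∷ w) l with i Fin.≟ l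
  ... | yes _ = bit b
  ... | no  _ = status b w l

  encode : Word k → Fin (suc k) → ℕ
  encode w Fin.zero    = bit (hasY w)
  encode w (Fin.suc j) = status false w (opposite j)

  status-here : ∀ b l w → status b (X l ∷ w) l ≡ bit b
  status-here b l w with l Fin.≟ l
  ... | yes _  = refl
  ... | no l≢l = contradiction refl l≢l

  status-there : ∀ b {i l} w → i ≢ l → status b (X i ∷ w) l ≡ status b w l
  status-there b {i} {l} w i≢l with i Fin.≟ l
  ... | yes i≡l = contradiction i≡l i≢l
  ... | no  _   = refl

  status≤2 : ∀ b w l → status b w l ℕ.≤ 2
  status≤2 b []        l = ℕ.≤-refl
  status≤2 b (Y _ ∷ w) l = status≤2 true w l
  status≤2 b (X i ∷ w) l with i Fin.≟ l
  ... | yes _ = ℕ.m≤n⇒m≤1+n (bit≤1 b)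
  ... | no  _ = status≤2 b w l

  status-true≢0 : ∀ w l → status true w l ≢ 0
  status-true≢0 []        l ()
  status-true≢0 (Y _ ∷ w) l = status-true≢0 w l
  status-true≢0 (X i ∷ w) l with i Fin.≟ l
  ... | yes _ = λ ()
  ... | no  _ = status-true≢0 w l

  status≡1⇒hasY : ∀ w l → status false w l ≡ 1 → hasY w ≡ true
  status≡1⇒hasY []        l ()
  status≡1⇒hasY (Y _ ∷ w) l _ = refl
  status≡1⇒hasY (X i ∷ w) l s≡1 with i Fin.≟ l
  ... | no _ = status≡1⇒hasY w l s≡1

  status≤status-true : ∀ b w l → status b w l ℕ.≤ status true w l
  status≤status-true true  w         l = ℕ.≤-refl
  status≤status-true false []        l = ℕ.≤-refl
  status≤status-true false (Y _ ∷ w) l = ℕ.≤-refl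
  status≤status-true false (X i ∷ w) l with i Fin.≟ l
  ... | yes _ = z≤n
  ... | no  _ = status≤status-true false w l

  status-below : ∀ b {i l} w → All (X i ≺_) w → toℕ l ℕ.≤ toℕ i → status b w l ≡ 2
  status-below b []        []       _   = refl
  status-below b (Y _ ∷ w) (_ ∷ ps) l≤i = status-below true w ps l≤i
  status-below b {l = l} (X j ∷ w) (i<j ∷ ps) l≤i with j Fin.≟ l
  ... | yes refl = contradiction l≤i (ℕ.<⇒≱ i<j)
  ... | no  _    = status-below b w ps l≤i

  hasY-after-Y : ∀ {j} w → All (Y j ≺_) w → hasY w ≡ false
  hasY-after-Y         []        []       = refl
  hasY-after-Y         (X _ ∷ w) (_ ∷ ps) = hasY-after-Y w ps
  hasY-after-Y {Fin.zero} (Y Fin.zero ∷ w) (() ∷ _)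

-- Position suc j of σ̃ concerns x_(opposite j), and ySlot reports s = 1 + the index of the x just
-- before y; so the left side says that this x comes after y, the right side is inYRange's test.
≤opposite⇔ : ∀ {k s} (j : Fin k) → s ℕ.≤ k →
             s ℕ.≤ toℕ (opposite j) ⇔ 2 + toℕ j ℕ.≤ suc k ∸ s
≤opposite⇔ {k} {s} j s≤k = mk⇔
  (λ s≤o → subst (2 + toℕ j ℕ.≤_) suc[k∸s]
             (s≤s (m≤o∸n⇒n≤o∸m (Fin.toℕ<n j) (subst (s ℕ.≤_) (Fin.opposite-prop j) s≤o))))
  (λ le → subst (s ℕ.≤_) (sym (Fin.opposite-prop j))
            (m≤o∸n⇒n≤o∸m s≤k (ℕ.s≤s⁻¹ (subst (2 + toℕ j ℕ.≤_) (sym suc[k∸s]) le))))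
  where
  suc[k∸s] : suc (k ∸ s) ≡ suc k ∸ s
  suc[k∸s] = sym (ℕ.+-∸-assoc 1 s≤k)

module _ {k : ℕ} where

  -- The accumulator q of ySlot is 1 + the index of the last x read, so all later x's are ≥ q.
  Above : ℕ → Letter k 1 → Set
  Above q (X i) = q ℕ.≤ toℕ i
  Above q (Y _) = ⊤

  above-head : ∀ {i} {w : Word k} → All (X i ≺_) w → All (Above (suc (toℕ i))) w
  above-head = All.map λ { {X _} i<j → i<j ; {Y _} _ → tt }

  above-zero : (w : Word k) → All (Above 0) w
  above-zero = All.universal λ { (X _) → z≤n ; (Y _) → tt }

  memX⇒above : ∀ {q l} (w : Word k) → All (Above q) w → memX l w ≡ true → q ℕ.≤ toℕ l
  memX⇒above         (Y _ ∷ w) (_ ∷ as) m = memX⇒above w as m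
  memX⇒above {l = l} (X i ∷ w) (a ∷ as) m with i Fin.≟ l
  ... | yes refl = a
  ... | no  _    = memX⇒above w as m

  hasY≡is-just-ySlot : ∀ q (w : Word k) → hasY w ≡ is-just (ySlot q w)
  hasY≡is-just-ySlot q []        = refl
  hasY≡is-just-ySlot q (Y _ ∷ w) = refl
  hasY≡is-just-ySlot q (X i ∷ w) = hasY≡is-just-ySlot (suc (toℕ i)) w

  ySlot≤ : ∀ q (w : Word k) {s} → q ℕ.≤ k → ySlot q w ≡ just s → s ℕ.≤ k
  ySlot≤ q (Y _ ∷ w) q≤k refl = q≤k
  ySlot≤ q (X i ∷ w) _   e    = ySlot≤ (suc (toℕ i)) w (Fin.toℕ<n i) e

  ySlot≥ : ∀ q (w : Word k) {s} → Sorted w → All (Above q) w → ySlot q w ≡ just s → q ℕ.≤ s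
  ySlot≥ q (Y _ ∷ w) _        _       refl = ℕ.≤-refl
  ySlot≥ q (X i ∷ w) (p ∷ ps) (a ∷ _) e    =
    ℕ.≤-trans (ℕ.m≤n⇒m≤1+n a) (ySlot≥ (suc (toℕ i)) w ps (above-head p) e)

  memX≡false⇒status≡2 : ∀ b (w : Word k) l → memX l w ≡ false → status b w l ≡ 2
  memX≡false⇒status≡2 b []        l _ = refl
  memX≡false⇒status≡2 b (Y _ ∷ w) l m = memX≡false⇒status≡2 true w l m
  memX≡false⇒status≡2 b (X i ∷ w) l m with i Fin.≟ l
  ... | no _ = memX≡false⇒status≡2 b w l m

  memX⇒status-true≡1 : ∀ (w : Word k) l → memX l w ≡ true → status true w l ≡ 1
  memX⇒status-true≡1 (Y _ ∷ w) l m = memX⇒status-true≡1 w l m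
  memX⇒status-true≡1 (X i ∷ w) l m with i Fin.≟ l
  ... | yes _ = refl
  ... | no  _ = memX⇒status-true≡1 w l m

  memX⇒status≡0 : ∀ (w : Word k) l → hasY w ≡ false → memX l w ≡ true → status false w l ≡ 0
  memX⇒status≡0 (X i ∷ w) l h m with i Fin.≟ l
  ... | yes _ = refl
  ... | no  _ = memX⇒status≡0 w l h m

  ySlot≤⇒status≡1 : ∀ q (w : Word k) {l s} → Sorted w → All (Above q) w → memX l w ≡ true →
                    ySlot q w ≡ just s → s ℕ.≤ toℕ l → status false w l ≡ 1
  ySlot≤⇒status≡1 q (Y _ ∷ w) {l} _ _ m _ _ = memX⇒status-true≡1 w l m
  ySlot≤⇒status≡1 q (X i ∷ w) {l} (p ∷ ps) _ m e s≤l with i Fin.≟ l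
  ... | yes refl = contradiction (ySlot≥ (suc (toℕ i)) w ps (above-head p) e) (ℕ.<⇒≱ (s≤s s≤l))
  ... | no  _    = ySlot≤⇒status≡1 (suc (toℕ i)) w ps (above-head p) m e s≤l

  <ySlot⇒status≡0 : ∀ q (w : Word k) {l s} → Sorted w → All (Above q) w → memX l w ≡ true →
                    ySlot q w ≡ just s → toℕ l ℕ.< s → status false w l ≡ 0
  <ySlot⇒status≡0 q (Y _ ∷ w) _ (_ ∷ as) m refl l<q = contradiction (memX⇒above w as m) (ℕ.<⇒≱ l<q)
  <ySlot⇒status≡0 q (X i ∷ w) {l} (p ∷ ps) _ m e l<s with i Fin.≟ l
  ... | yes _ = refl
  ... | no  _ = <ySlot⇒status≡0 (suc (toℕ i)) w ps (above-head p) m e l<s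

  σ̃≗encode : (w : Word k) → Sorted w → ∀ i → σ̃ w i ≡ encode w i
  σ̃≗encode w _ Fin.zero with ySlot 0 w in e | hasY≡is-just-ySlot 0 w
  ... | nothing | hasY≡false rewrite hasY≡false = refl
  ... | just s  | hasY≡true  rewrite hasY≡true with 1 ℕ.≤? suc k ∸ s
  ...   | yes _   = refl
  ...   | no  1≰  = contradiction (subst (1 ℕ.≤_) (sym (ℕ.+-∸-assoc 1 (ySlot≤ 0 w z≤n e))) (s≤s z≤n))
                                  1≰
  σ̃≗encode w sorted (Fin.suc j) with memX (opposite j) w in m
  ... | false = sym (memX≡false⇒status≡2 false w (opposite j) m)
  ... | true with ySlot 0 w in e
  ...   | nothing = sym (memX⇒status≡0 w (opposite j) (trans (hasY≡is-just-ySlot 0 w) (cong is-just e)) m)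
  ...   | just s with 2 + toℕ j ℕ.≤? suc k ∸ s | ≤opposite⇔ j (ySlot≤ 0 w z≤n e)
  ...     | yes le  | s≤o⇔ = sym (ySlot≤⇒status≡1 0 w sorted (above-zero w) m e
                                                   (Equivalence.from s≤o⇔ le))
  ...     | no  ¬le | s≤o⇔ = sym (<ySlot⇒status≡0 0 w sorted (above-zero w) m e
                                                   (ℕ.≰⇒> (¬le ∘ Equivalence.to s≤o⇔)))

  status≡0⇒false : ∀ b (w : Word k) l → status b w l ≡ 0 → b ≡ false
  status≡0⇒false true  w l s≡0 = contradiction s≡0 (status-true≢0 w l)
  status≡0⇒false false w l _   = refl

  status≡0⇒lower≢1 : ∀ b (w : Word k) {l l′} → Sorted w → l Fin.< l′ →
                     status b w l′ ≡ 0 → status b w l ≢ 1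
  status≡0⇒lower≢1 b []        _ _ ()
  status≡0⇒lower≢1 b (Y _ ∷ w) {l′ = l′} _ _ s≡0 = contradiction s≡0 (status-true≢0 w l′)
  status≡0⇒lower≢1 b (X i ∷ w) {l} {l′} (p ∷ ps) l<l′ s≡0 with i Fin.≟ l′ | i Fin.≟ l
  ... | yes refl | yes refl = contradiction l<l′ (ℕ.<-irrefl refl)
  ... | yes refl | no  _    = λ s≡1 →
    contradiction (trans (sym (status-below b w p (ℕ.<⇒≤ l<l′))) s≡1) λ ()
  ... | no  _    | yes refl rewrite status≡0⇒false b w l′ s≡0 = λ ()
  ... | no  _    | no  _    = status≡0⇒lower≢1 b w ps l<l′ s≡0

  encode-isTri : (w : Word k) → Sorted w → IsTri (encode w)
  encode-isTri w sorted = encode≤2 , encode-zero≢2 , encode-0⇒later≢1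
    where
    encode≤2 : ∀ i → encode w i ℕ.≤ 2
    encode≤2 Fin.zero    = ℕ.m≤n⇒m≤1+n (bit≤1 (hasY w))
    encode≤2 (Fin.suc j) = status≤2 false w (opposite j)

    encode-zero≢2 : ∀ i → toℕ i ≡ 0 → encode w i ≢ 2
    encode-zero≢2 Fin.zero _ with hasY w
    ... | true  = λ ()
    ... | false = λ ()

    encode-0⇒later≢1 : ∀ i j → i Fin.< j → encode w i ≡ 0 → encode w j ≢ 1
    encode-0⇒later≢1 Fin.zero (Fin.suc j) _ e≡0 with hasY w in h
    ... | false = λ s≡1 → contradiction (trans (sym h) (status≡1⇒hasY w (opposite j) s≡1)) λ ()
    encode-0⇒later≢1 (Fin.suc i) (Fin.suc j) (s≤s i<j) e≡0 =
      status≡0⇒lower≢1 false w sorted (opposite-< i<j) e≡0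

  private
    heads-< : ∀ b {i j} (u v : Word k) → All (X j ≺_) v → i Fin.< j →
              status b (X i ∷ u) i ≢ status b (X j ∷ v) i
    heads-< b {i} {j} u v ps i<j eq = bit≢2 b (begin
      bit b                  ≡⟨ sym (status-here b i u) ⟩
      status b (X i ∷ u) i   ≡⟨ eq ⟩
      status b (X j ∷ v) i   ≡⟨ status-there b v (λ j≡i → ℕ.<-irrefl (cong toℕ (sym j≡i)) i<j) ⟩
      status b v i           ≡⟨ status-below b v ps (ℕ.<⇒≤ i<j) ⟩
      2                      ∎)
      where open ≡-Reasoning

    X-vs-Y : ∀ b {i} (u v : Word k) → (b ≡ true → true ≡ false) →
             status b (X i ∷ u) i ≢ status true v i
    X-vs-Y true  u v noY _  = contradiction (noY refl) λ ()
    X-vs-Y false {i} u v _ eq = status-true≢0 v i (sym (trans (sym (status-here false i u)) eq))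

  status-injective : ∀ b (u v : Word k) → Sorted u → Sorted v →
                     hasY u ≡ hasY v → (b ≡ true → hasY v ≡ false) →
                     (∀ l → status b u l ≡ status b v l) → u ≡ v
  status-injective b []        []        _ _ _ _ _ = refl
  status-injective b []        (X i ∷ v) _ _ _ _ eq =
    contradiction (trans (sym (status-here b i v)) (sym (eq i))) (bit≢2 b)
  status-injective b (X i ∷ u) []        _ _ _ _ eq =
    contradiction (trans (sym (status-here b i u)) (eq i)) (bit≢2 b)
  status-injective b (X i ∷ u) (Y _ ∷ v) _ _ _ noY eq = contradiction (eq i) (X-vs-Y b u v noY)
  status-injective b (Y _ ∷ u) (X i ∷ v) _ _ hY noY eq =
    contradiction (sym (eq i)) (X-vs-Y b v u (λ b≡true → trans hY (noY b≡true)))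
  status-injective b (X i ∷ u) (X j ∷ v) (p ∷ ps) (q ∷ qs) hY noY eq with Fin.<-cmp i j
  ... | tri< i<j _ _ = contradiction (eq i) (heads-< b u v q i<j)
  ... | tri> _ _ j<i = contradiction (sym (eq j)) (heads-< b v u p j<i)
  ... | tri≈ _ refl _ = cong (X i ∷_) (status-injective b u v ps qs hY noY tails)
    where
    tails : ∀ l → status b u l ≡ status b v l
    tails l with i Fin.≟ l
    ... | yes refl = trans (status-below b u p ℕ.≤-refl) (sym (status-below b v q ℕ.≤-refl))
    ... | no  i≢l  = trans (sym (status-there b u i≢l)) (trans (eq l) (status-there b v i≢l))
  status-injective b (Y Fin.zero ∷ u) (Y Fin.zero ∷ v) (p ∷ ps) (q ∷ qs) _ _ eq =
    cong (Y Fin.zero ∷_) (status-injective true u v ps qs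
      (trans (hasY-after-Y u p) (sym (hasY-after-Y v q))) (λ _ → hasY-after-Y v q) eq)

  encode-injective : (u v : Word k) → Sorted u → Sorted v →
                     (∀ i → encode u i ≡ encode v i) → u ≡ v
  encode-injective u v su sv eq =
    status-injective false u v su sv (bit-injective (eq Fin.zero)) (λ ())
      (λ l → subst (λ l → status false u l ≡ status false v l) (Fin.opposite-involutive l)
                   (eq (Fin.suc (opposite l))))

module _ {k : ℕ} where

  liftLetter : Letter k 1 → Letter (suc k) 1
  liftLetter (X i) = X (Fin.suc i)
  liftLetter (Y j) = Y j

  lift : Word k → Word (suc k)
  lift = List.map liftLetter

  ≺-lift : ∀ {a b} → a ≺ b → liftLetter a ≺ liftLetter b
  ≺-lift {X _} {X _} i<j = s≤s i<j
  ≺-lift {X _} {Y _} _   = tt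
  ≺-lift {Y _} {X _} _   = tt
  ≺-lift {Y Fin.zero} {Y Fin.zero} ()

  lift-sorted : {w : Word k} → Sorted w → Sorted (lift w)
  lift-sorted = AllPairs.map⁺ ∘ AllPairs.map ≺-lift

  zero≺lift : (w : Word k) → All (X Fin.zero ≺_) (lift w)
  zero≺lift = All.map⁺ ∘ All.universal λ { (X _) → s≤s z≤n ; (Y _) → tt }

  hasY-lift : (w : Word k) → hasY (lift w) ≡ hasY w
  hasY-lift []        = refl
  hasY-lift (X _ ∷ w) = hasY-lift w
  hasY-lift (Y _ ∷ w) = refl

  status-lift-zero : ∀ b (w : Word k) → status b (lift w) Fin.zero ≡ 2
  status-lift-zero b []        = refl
  status-lift-zero b (Y _ ∷ w) = status-lift-zero true w
  status-lift-zero b (X i ∷ w) = status-lift-zero b w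

  status-lift-suc : ∀ b (w : Word k) l → status b (lift w) (Fin.suc l) ≡ status b w l
  status-lift-suc b []        l = refl
  status-lift-suc b (Y _ ∷ w) l = status-lift-suc true w l
  status-lift-suc b (X i ∷ w) l with Fin.suc i Fin.≟ Fin.suc l | i Fin.≟ l
  ... | yes _  | yes _  = refl
  ... | no  _  | no  _  = status-lift-suc b w l
  ... | yes si≡sl | no i≢l = contradiction (Fin.suc-injective si≡sl) i≢l
  ... | no si≢sl  | yes i≡l = contradiction (cong Fin.suc i≡l) si≢sl

  status-X-zero-lift : ∀ b (w : Word k) l →
                       status b (X Fin.zero ∷ lift w) (Fin.suc l) ≡ status b w l
  status-X-zero-lift b w l = trans (status-there b {Fin.zero} (lift w) λ ()) (status-lift-suc b w l)

noY⇒Y≺ : ∀ {k} (w : Word k) → hasY w ≡ false → All (Y Fin.zero ≺_) w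
noY⇒Y≺ []        _ = []
noY⇒Y≺ (X _ ∷ w) h = tt ∷ noY⇒Y≺ w h

-- decode k y g is the word whose letter x_l has status g l; the flag y says that y is
-- still to be placed, which happens just before the first letter of status 1 (or at the end).
decode : ∀ k → Bool → (Fin k → ℕ) → Word k
decode zero    true  _ = Y Fin.zero ∷ []
decode zero    false _ = []
decode (suc k) y     g = place (g Fin.zero) y λ y′ → lift (decode k y′ (g ∘ Fin.suc))
  where
  place : ℕ → Bool → (Bool → Word (suc k)) → Word (suc k)
  place 0             y     rest = X Fin.zero ∷ rest y
  place 1             true  rest = Y Fin.zero ∷ X Fin.zero ∷ rest false
  place 1             false rest = X Fin.zero ∷ rest false
  place (suc (suc _)) y     rest = rest y

hasY-decode : ∀ k y g → hasY (decode k y g) ≡ y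
hasY-decode zero    true  _ = refl
hasY-decode zero    false _ = refl
hasY-decode (suc k) y     g with g Fin.zero | y
... | 0           | y′    = trans (hasY-lift (decode k y′ (g ∘ Fin.suc))) (hasY-decode k y′ _)
... | 1           | true  = refl
... | 1           | false = trans (hasY-lift (decode k false (g ∘ Fin.suc))) (hasY-decode k false _)
... | suc (suc _) | y′    = trans (hasY-lift (decode k y′ (g ∘ Fin.suc))) (hasY-decode k y′ _)

decode-sorted : ∀ k y g → Sorted (decode k y g)
decode-sorted zero    true  _ = [] ∷ []
decode-sorted zero    false _ = []
decode-sorted (suc k) y     g with g Fin.zero | y
... | 0           | y′    = zero≺lift (decode k y′ (g ∘ Fin.suc)) ∷ lift-sorted (decode-sorted k y′ _)
... | 1           | true  =
  noY⇒Y≺ (X Fin.zero ∷ lift rest) (trans (hasY-lift rest) (hasY-decode k false _)) ∷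
  zero≺lift rest ∷ lift-sorted (decode-sorted k false _)
  where rest = decode k false (g ∘ Fin.suc)
... | 1           | false = zero≺lift (decode k false (g ∘ Fin.suc)) ∷ lift-sorted (decode-sorted k false _)
... | suc (suc _) | y′    = lift-sorted (decode-sorted k y′ _)

status-true-decode : ∀ k g → (∀ l → g l ℕ.≤ 2) → (∀ l → g l ≢ 0) →
                     ∀ l → status true (decode k false g) l ≡ g l
status-true-decode (suc k) g ≤2 ≢0 l with g Fin.zero in e
... | 0                 = contradiction e (≢0 Fin.zero)
... | suc (suc (suc _)) = contradiction e (≤2⇒≢3+ (≤2 Fin.zero))
status-true-decode (suc k) g ≤2 ≢0 Fin.zero    | 1 = sym e
status-true-decode (suc k) g ≤2 ≢0 (Fin.suc l) | 1 =
  trans (status-X-zero-lift true (decode k false (g ∘ Fin.suc)) l)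
        (status-true-decode k (g ∘ Fin.suc) (≤2 ∘ Fin.suc) (≢0 ∘ Fin.suc) l)
status-true-decode (suc k) g ≤2 ≢0 Fin.zero    | 2 =
  trans (status-lift-zero true (decode k false (g ∘ Fin.suc))) (sym e)
status-true-decode (suc k) g ≤2 ≢0 (Fin.suc l) | 2 =
  trans (status-lift-suc true (decode k false (g ∘ Fin.suc)) l)
        (status-true-decode k (g ∘ Fin.suc) (≤2 ∘ Fin.suc) (≢0 ∘ Fin.suc) l)

status-decode : ∀ k y g → (∀ l → g l ℕ.≤ 2) → (∀ {l l′} → l Fin.< l′ → g l′ ≡ 0 → g l ≢ 1) →
                (y ≡ false → ∀ l → g l ≢ 1) → ∀ l → status false (decode k y g) l ≡ g l
status-decode (suc k) y g ≤2 0⇒≢1 ¬y⇒≢1 l with g Fin.zero in e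
... | suc (suc (suc _)) = contradiction e (≤2⇒≢3+ (≤2 Fin.zero))
status-decode (suc k) false g ≤2 0⇒≢1 ¬y⇒≢1 l | 1 = contradiction e (¬y⇒≢1 refl Fin.zero)
status-decode (suc k) y g ≤2 0⇒≢1 ¬y⇒≢1 Fin.zero    | 0 = sym e
status-decode (suc k) y g ≤2 0⇒≢1 ¬y⇒≢1 (Fin.suc l) | 0 =
  trans (status-X-zero-lift false (decode k y (g ∘ Fin.suc)) l)
        (status-decode k y _ (≤2 ∘ Fin.suc) (0⇒≢1 ∘ s≤s) (λ ¬y → ¬y⇒≢1 ¬y ∘ Fin.suc) l)
status-decode (suc k) true g ≤2 0⇒≢1 ¬y⇒≢1 Fin.zero    | 1 = sym e
status-decode (suc k) true g ≤2 0⇒≢1 ¬y⇒≢1 (Fin.suc l) | 1 =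
  trans (status-X-zero-lift true (decode k false (g ∘ Fin.suc)) l)
        (status-true-decode k _ (≤2 ∘ Fin.suc) (λ _ g≡0 → 0⇒≢1 (s≤s z≤n) g≡0 e) l)
status-decode (suc k) y g ≤2 0⇒≢1 ¬y⇒≢1 Fin.zero    | 2 =
  trans (status-lift-zero false (decode k y (g ∘ Fin.suc))) (sym e)
status-decode (suc k) y g ≤2 0⇒≢1 ¬y⇒≢1 (Fin.suc l) | 2 =
  trans (status-lift-suc false (decode k y (g ∘ Fin.suc)) l)
        (status-decode k y _ (≤2 ∘ Fin.suc) (0⇒≢1 ∘ s≤s) (λ ¬y → ¬y⇒≢1 ¬y ∘ Fin.suc) l)

module _ {k : ℕ} where

  hasY-++ : (a c : Word k) → hasY (a ++ c) ≡ hasY a ∨ hasY c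
  hasY-++ []        c = refl
  hasY-++ (X _ ∷ a) c = hasY-++ a c
  hasY-++ (Y _ ∷ a) c = refl

  hasY-delete : ∀ (a : Word k) {i c} → hasY (a ++ X i ∷ c) ≡ hasY (a ++ c)
  hasY-delete a {i} {c} = trans (hasY-++ a (X i ∷ c)) (sym (hasY-++ a c))

  hasY-insert : ∀ (a : Word k) {j c} → hasY (a ++ Y j ∷ c) ≡ true
  hasY-insert a {j} {c} = trans (hasY-++ a (Y j ∷ c)) (∨-zeroʳ (hasY a))

  status-delete-other : ∀ b (a : Word k) {i c l} → i ≢ l →
                        status b (a ++ X i ∷ c) l ≡ status b (a ++ c) l
  status-delete-other b []        {c = c} i≢l = status-there b c i≢l
  status-delete-other b (Y _ ∷ a) i≢l = status-delete-other true a i≢l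
  status-delete-other b (X j ∷ a) {l = l} i≢l with j Fin.≟ l
  ... | yes _ = refl
  ... | no  _ = status-delete-other b a i≢l

  status-delete-self : ∀ b (a : Word k) {i c} → Sorted (a ++ X i ∷ c) → status b (a ++ c) i ≡ 2
  status-delete-self b []        {c = c} (p ∷ _) = status-below b c p ℕ.≤-refl
  status-delete-self b (Y _ ∷ a) (_ ∷ ps) = status-delete-self true a ps
  status-delete-self b (X j ∷ a) {i} (p ∷ ps) with j Fin.≟ i
  ... | yes refl = contradiction (All.++⁻ʳ a p) λ { (i<i ∷ _) → ℕ.<-irrefl refl i<i }
  ... | no  _    = status-delete-self b a ps

  status-insert-≤ : ∀ b (a : Word k) {j c} l → status b (a ++ c) l ℕ.≤ status b (a ++ Y j ∷ c) l
  status-insert-≤ b []        {c = c} l = status≤status-true b c l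
  status-insert-≤ b (Y _ ∷ a) l = status-insert-≤ true a l
  status-insert-≤ b (X i ∷ a) l with i Fin.≟ l
  ... | yes _ = ℕ.≤-refl
  ... | no  _ = status-insert-≤ b a l

  status-swap-other : ∀ b (a : Word k) {i j c l} → i ≢ l →
                      status b (a ++ X i ∷ Y j ∷ c) l ≡ status b (a ++ Y j ∷ X i ∷ c) l
  status-swap-other b a {i} {j} {c} {l} i≢l = begin
    status b (a ++ X i ∷ Y j ∷ c) l            ≡⟨ status-delete-other b a i≢l ⟩
    status b (a ++ Y j ∷ c) l                  ≡⟨ cong (λ w → status b w l) (List.++-assoc a _ c) ⟨
    status b ((a ++ Y j ∷ []) ++ c) l          ≡⟨ status-delete-other b (a ++ Y j ∷ []) i≢l ⟨
    status b ((a ++ Y j ∷ []) ++ X i ∷ c) l    ≡⟨ cong (λ w → status b w l) (List.++-assoc a _ (X i ∷ c)) ⟩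
    status b (a ++ Y j ∷ X i ∷ c) l            ∎
    where open ≡-Reasoning

  status-swap-self : ∀ (a : Word k) {i j c} → Sorted (a ++ X i ∷ Y j ∷ c) →
                     status false (a ++ X i ∷ Y j ∷ c) i ≡ 0 × status false (a ++ Y j ∷ X i ∷ c) i ≡ 1
  status-swap-self []        {i} {c = c} _ = status-here false i _ , status-here true i c
  status-swap-self (Y Fin.zero ∷ a) {j = Fin.zero} (p ∷ _) with All.++⁻ʳ a p
  ... | _ ∷ () ∷ _
  status-swap-self (X j ∷ a) {i} (p ∷ ps) with j Fin.≟ i
  ... | yes refl = contradiction (All.++⁻ʳ a p) λ { (i<i ∷ _) → ℕ.<-irrefl refl i<i }
  ... | no  _    = status-swap-self a ps

  status-∷ʳ-Y : ∀ b (w : Word k) {j} l → status b (w ++ Y j ∷ []) l ≡ status b w l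
  status-∷ʳ-Y b []        l = refl
  status-∷ʳ-Y b (Y _ ∷ w) l = status-∷ʳ-Y true w l
  status-∷ʳ-Y b (X i ∷ w) l with i Fin.≟ l
  ... | yes _ = refl
  ... | no  _ = status-∷ʳ-Y b w l

  sorted-∷ʳ-Y : (w : Word k) → Sorted w → hasY w ≡ false → Sorted (w ++ Y Fin.zero ∷ [])
  sorted-∷ʳ-Y []        _        _ = [] ∷ []
  sorted-∷ʳ-Y (X _ ∷ w) (p ∷ ps) h = All.++⁺ p (tt ∷ []) ∷ sorted-∷ʳ-Y w ps h

  infix 4 _⊑_
  record _⊑_ (u v : Word k) : Set where
    constructor mk⊑
    field
      hasY-≤   : bit (hasY u) ℕ.≤ bit (hasY v)
      status-≤ : ∀ l → status false u l ℕ.≤ status false v l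
  open _⊑_

  ⊑-refl : ∀ {u} → u ⊑ u
  ⊑-refl = mk⊑ ℕ.≤-refl (λ _ → ℕ.≤-refl)

  ⊑-trans : ∀ {u v w} → u ⊑ v → v ⊑ w → u ⊑ w
  ⊑-trans u⊑v v⊑w = mk⊑ (ℕ.≤-trans (hasY-≤ u⊑v) (hasY-≤ v⊑w))
                        (λ l → ℕ.≤-trans (status-≤ u⊑v l) (status-≤ v⊑w l))

  encode-≤⇒⊑ : ∀ {u v} → encode u ≤comp encode v → u ⊑ v
  encode-≤⇒⊑ {u} {v} le = mk⊑ (le Fin.zero) λ l →
    subst (λ l → status false u l ℕ.≤ status false v l) (Fin.opposite-involutive l)
          (le (Fin.suc (opposite l)))

  ⊑⇒encode-≤ : ∀ {u v} → u ⊑ v → encode u ≤comp encode v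
  ⊑⇒encode-≤ u⊑v Fin.zero    = hasY-≤ u⊑v
  ⊑⇒encode-≤ u⊑v (Fin.suc j) = status-≤ u⊑v (opposite j)

  step-sorted : ∀ {w w′ : Word k} → Step w w′ → Sorted w′
  step-sorted (delete a _ _ sh)      = AllPairs-delete a (isShuf⇒sorted sh)
  step-sorted (insert _ _ _ _ sh′)   = isShuf⇒sorted sh′
  step-sorted (transpose a _ _ _ sh) = AllPairs-swap a tt (isShuf⇒sorted sh)

  step-⊑ : ∀ {w w′ : Word k} → Step w w′ → w ⊑ w′
  step-⊑ (delete a c i sh) = mk⊑ (ℕ.≤-reflexive (cong bit (hasY-delete a))) status-mono
    where
    status-mono : ∀ l → status false (a ++ X i ∷ c) l ℕ.≤ status false (a ++ c) l
    status-mono l with i Fin.≟ l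
    ... | yes refl = subst (status false (a ++ X i ∷ c) i ℕ.≤_)
                           (sym (status-delete-self false a (isShuf⇒sorted sh)))
                           (status≤2 false (a ++ X i ∷ c) i)
    ... | no  i≢l  = ℕ.≤-reflexive (status-delete-other false a i≢l)
  step-⊑ (insert a c j _ _) =
    mk⊑ (bit≤bit-true _ (hasY-insert a)) (status-insert-≤ false a)
  step-⊑ (transpose a c i j sh) =
    mk⊑ (ℕ.≤-reflexive (cong bit (trans (hasY-++ a _) (sym (hasY-++ a _))))) status-mono
    where
    status-mono : ∀ l → status false (a ++ X i ∷ Y j ∷ c) l ℕ.≤ status false (a ++ Y j ∷ X i ∷ c) l
    status-mono l with i Fin.≟ l
    ... | yes refl = subst (ℕ._≤ status false (a ++ Y j ∷ X i ∷ c) i)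
                           (sym (proj₁ (status-swap-self a (isShuf⇒sorted sh)))) z≤n
    ... | no  i≢l  = ℕ.≤-reflexive (status-swap-other false a i≢l)

  Star-⊑ : ∀ {w w′ : Word k} → Star Step w w′ → w ⊑ w′
  Star-⊑ ε        = ⊑-refl
  Star-⊑ (s ◅ ss) = ⊑-trans (step-⊑ s) (Star-⊑ ss)

  data Occurs (l : Fin k) : Word k → Set where
    occurs : ∀ a c → Occurs l (a ++ X l ∷ c)

  status≢2⇒occurs : ∀ b (w : Word k) l → status b w l ≢ 2 → Occurs l w
  status≢2⇒occurs b []        l s≢2 = contradiction refl s≢2
  status≢2⇒occurs b (Y j ∷ w) l s≢2 with status≢2⇒occurs true w l s≢2
  ... | occurs a c = occurs (Y j ∷ a) c
  status≢2⇒occurs b (X i ∷ w) l s≢2 with i Fin.≟ l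
  ... | yes refl = occurs [] w
  ... | no  _ with status≢2⇒occurs b w l s≢2
  ...   | occurs a c = occurs (X i ∷ a) c

  data PrecedesY (l : Fin k) : Word k → Set where
    precedesY : ∀ a {i} c → toℕ l ℕ.≤ toℕ i → PrecedesY l (a ++ X i ∷ Y Fin.zero ∷ c)

  precedesY-∷ : ∀ {l i w} → PrecedesY l w → PrecedesY l (X i ∷ w)
  precedesY-∷ {i = i} (precedesY a c l≤j) = precedesY (X i ∷ a) c l≤j

  precedesY-≤ : ∀ {l l′ w} → toℕ l′ ℕ.≤ toℕ l → PrecedesY l w → PrecedesY l′ w
  precedesY-≤ l′≤l (precedesY a c l≤i) = precedesY a c (ℕ.≤-trans l′≤l l≤i)

  status≡0⇒precedesY : ∀ (w : Word k) l → Sorted w → hasY w ≡ true → status false w l ≡ 0 →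
                       PrecedesY l w
  status≡0⇒precedesY (Y _ ∷ w)              l _ _ s≡0 = contradiction s≡0 (status-true≢0 w l)
  status≡0⇒precedesY (X i ∷ Y Fin.zero ∷ c) l _ _ s≡0 with i Fin.≟ l
  ... | yes refl = precedesY [] c ℕ.≤-refl
  ... | no  _    = contradiction s≡0 (status-true≢0 c l)
  status≡0⇒precedesY (X i ∷ X j ∷ c) l ((i<j ∷ _) ∷ ps) h s≡0 with i Fin.≟ l
  ... | yes refl = precedesY-∷ (precedesY-≤ (ℕ.<⇒≤ i<j)
                                  (status≡0⇒precedesY (X j ∷ c) j ps h (status-here false j c)))
  ... | no  _    = precedesY-∷ (status≡0⇒precedesY (X j ∷ c) l ps h s≡0)

  weight : Word k → ℕ
  weight w = bit (hasY w) + total (status false w)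

  ⊑⇒weight≤ : ∀ {u v} → u ⊑ v → weight u ℕ.≤ weight v
  ⊑⇒weight≤ u⊑v = ℕ.+-mono-≤ (hasY-≤ u⊑v) (total-mono (status-≤ u⊑v))

  weight-<-hasY : ∀ {u v} → u ⊑ v → hasY u ≡ false → hasY v ≡ true → weight u ℕ.< weight v
  weight-<-hasY u⊑v hu hv = ℕ.+-mono-<-≤ (bit<bit hu hv) (total-mono (status-≤ u⊑v))

  weight-<-status : ∀ {u v} l → u ⊑ v → status false u l ℕ.< status false v l → weight u ℕ.< weight v
  weight-<-status l u⊑v u<v = ℕ.+-mono-≤-< (hasY-≤ u⊑v) (total-mono-< (status-≤ u⊑v) l u<v)

  record Progress (u v : Word k) : Set where
    constructor progress
    field
      {next}  : Word k
      step    : Step u next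
      below   : next ⊑ v
      heavier : weight u ℕ.< weight next

  delete-progress : ∀ {u v : Word k} l → Sorted u → u ⊑ v → status false u l ≢ 2 → status false v l ≡ 2 →
                    Progress u v
  delete-progress {u} {v} l su u⊑v u≢2 v≡2 with status≢2⇒occurs false u l u≢2
  ... | occurs a c = progress step below (weight-<-status l (step-⊑ step)
    (subst (status false u l ℕ.<_) (sym deleted) (ℕ.≤∧≢⇒< (status≤2 false u l) u≢2)))
    where
    step = delete a c l (sorted⇒isShuf su)
    deleted = status-delete-self false a su
    below : a ++ c ⊑ v
    below = mk⊑ (subst (λ b → bit b ℕ.≤ _) (hasY-delete a) (hasY-≤ u⊑v)) status-below-v
      where
      status-below-v : ∀ l′ → status false (a ++ c) l′ ℕ.≤ status false v l′
      status-below-v l′ with l Fin.≟ l′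
      ... | yes refl = ℕ.≤-reflexive (trans deleted (sym v≡2))
      ... | no  l≢l′ = subst (ℕ._≤ _) (status-delete-other false a l≢l′) (status-≤ u⊑v l′)

  append-progress : ∀ {u v : Word k} → Sorted u → u ⊑ v → hasY u ≡ false → hasY v ≡ true → Progress u v
  append-progress {u} {v} su u⊑v hu hv =
    progress step below (weight-<-hasY (step-⊑ step) hu (hasY-insert u))
    where
    step : Step u (u ++ Y Fin.zero ∷ [])
    step = subst (λ w → Step w (u ++ Y Fin.zero ∷ [])) (List.++-identityʳ u)
             (insert u [] Fin.zero (subst IsShuf (sym (List.++-identityʳ u)) (sorted⇒isShuf su))
                                   (sorted⇒isShuf (sorted-∷ʳ-Y u su hu)))
    below : u ++ Y Fin.zero ∷ [] ⊑ v
    below = mk⊑ (bit≤bit-true _ hv)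
                (λ l → subst (ℕ._≤ _) (sym (status-∷ʳ-Y false u l)) (status-≤ u⊑v l))

  swap-progress : ∀ {u v : Word k} {l} → PrecedesY l u → Sorted u → Sorted v → u ⊑ v →
                  status false v l ≡ 1 → hasY v ≡ true → Progress u v
  swap-progress {v = v} {l} (precedesY a {i} c l≤i) su sv u⊑v v≡1 hv =
    progress step below (weight-<-status i (step-⊑ step)
      (subst₂ ℕ._<_ (sym (proj₁ swapped)) (sym (proj₂ swapped)) ℕ.≤-refl))
    where
    step = transpose a c i Fin.zero (sorted⇒isShuf su)
    swapped = status-swap-self a su
    v-i≥1 : 1 ℕ.≤ status false v i
    v-i≥1 with ℕ.m≤n⇒m<n∨m≡n l≤i
    ... | inj₁ l<i = ℕ.n≢0⇒n>0 λ v-i≡0 → status≡0⇒lower≢1 false v sv l<i v-i≡0 v≡1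
    ... | inj₂ l≡i rewrite Fin.toℕ-injective l≡i = ℕ.≤-reflexive (sym v≡1)
    below : a ++ Y Fin.zero ∷ X i ∷ c ⊑ v
    below = mk⊑ (bit≤bit-true _ hv) status-below-v
      where
      status-below-v : ∀ l′ → status false (a ++ Y Fin.zero ∷ X i ∷ c) l′ ℕ.≤ status false v l′
      status-below-v l′ with i Fin.≟ l′
      ... | yes refl = subst (ℕ._≤ _) (sym (proj₂ swapped)) v-i≥1
      ... | no  i≢l′ = subst (ℕ._≤ _) (status-swap-other false a i≢l′) (status-≤ u⊑v l′)

  ⊑-squeeze : ∀ {u v : Word k} → Sorted u → Sorted v → u ⊑ v → hasY u ≡ hasY v →
              (∀ l → ¬ (status false u l ≢ 2 × status false v l ≡ 2)) →
              (∀ l → ¬ (status false u l ≡ 0 × status false v l ≡ 1)) → u ≡ v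
  ⊑-squeeze {u} {v} su sv u⊑v hY ¬deletable ¬swappable = status-injective false u v su sv hY (λ ())
    λ l → ≤2-squeeze (status-≤ u⊑v l) (status≤2 false v l) (¬deletable l) (¬swappable l)

  ⊑⇒≡⊎progress : ∀ {u v : Word k} → Sorted u → Sorted v → u ⊑ v → u ≡ v ⊎ Progress u v
  ⊑⇒≡⊎progress {u} {v} su sv u⊑v
    with Fin.any? (λ l → ¬? (status false u l ℕ.≟ 2) ×-dec (status false v l ℕ.≟ 2))
  ... | yes (l , u≢2 , v≡2) = inj₂ (delete-progress l su u⊑v u≢2 v≡2)
  ... | no ¬deletable with hasY u in hu | hasY v in hv
  ...   | true  | false = contradiction (trans (sym hv) (bit≤bit⇒true (hasY-≤ u⊑v) hu)) λ ()
  ...   | false | true  = inj₂ (append-progress su u⊑v hu hv)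
  ...   | false | false = inj₁ (⊑-squeeze su sv u⊑v (trans hu (sym hv)) (λ l → ¬deletable ∘ (l ,_))
                                 λ l (_ , v≡1) → contradiction (trans (sym hv) (status≡1⇒hasY v l v≡1)) λ ())
  ...   | true  | true with Fin.any? (λ l → (status false u l ℕ.≟ 0) ×-dec (status false v l ℕ.≟ 1))
  ...     | yes (l , u≡0 , v≡1) = inj₂ (swap-progress (status≡0⇒precedesY u l su hu u≡0) su sv u⊑v v≡1 hv)
  ...     | no ¬swappable = inj₁ (⊑-squeeze su sv u⊑v (trans hu (sym hv)) (λ l → ¬deletable ∘ (l ,_))
                                   (λ l → ¬swappable ∘ (l ,_)))

  private
    reach : ∀ n {u v : Word k} → Sorted u → Sorted v → u ⊑ v → weight v ℕ.≤ n + weight u →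
            Star Step u v
    reach n su sv u⊑v bound with ⊑⇒≡⊎progress su sv u⊑v
    ... | inj₁ refl = ε
    reach zero su sv u⊑v bound | inj₂ (progress step below heavier) =
      contradiction (ℕ.<-≤-trans heavier (ℕ.≤-trans (⊑⇒weight≤ below) bound)) (ℕ.<-irrefl refl)
    reach (suc n) {u} su sv u⊑v bound | inj₂ (progress {next} step below heavier) =
      step ◅ reach n (step-sorted step) sv below
               (ℕ.≤-trans bound (subst (ℕ._≤ n + weight next) (ℕ.+-suc n (weight u))
                                       (ℕ.+-monoʳ-≤ n heavier)))

  ⊑⇒Star : ∀ {u v : Word k} → Sorted u → Sorted v → u ⊑ v → Star Step u v
  ⊑⇒Star {v = v} su sv u⊑v = reach (weight v) su sv u⊑v (ℕ.m≤m+n _ _)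

module _ {k : ℕ} where

  fromTriword : Tri (suc k) → Word k
  fromTriword (t , _) = decode k (t Fin.zero ℕ.≡ᵇ 1) (t ∘ Fin.suc ∘ opposite)

  fromTriword-sorted : ∀ t → Sorted (fromTriword t)
  fromTriword-sorted (t , _) = decode-sorted k _ _

  first≤1 : (t : Tri (suc k)) → proj₁ t Fin.zero ℕ.≤ 1
  first≤1 (_ , ≤2 , first≢2 , _) = ℕ.s≤s⁻¹ (ℕ.≤∧≢⇒< (≤2 Fin.zero) (first≢2 Fin.zero refl))

  encode-fromTriword : ∀ t i → encode (fromTriword t) i ≡ proj₁ t i
  encode-fromTriword t@(f , _) Fin.zero
    rewrite hasY-decode k (f Fin.zero ℕ.≡ᵇ 1) (f ∘ Fin.suc ∘ opposite) = bit[n≡ᵇ1]≡n (first≤1 t)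
  encode-fromTriword t@(f , ≤2 , _ , 0⇒≢1) (Fin.suc j) =
    trans (status-decode k _ _ (≤2 ∘ Fin.suc ∘ opposite)
                         (λ l<l′ → 0⇒≢1 _ _ (s≤s (opposite-< l<l′)))
                         (λ y≡false l → 0⇒≢1 Fin.zero _ (s≤s z≤n) ([n≡ᵇ1]≡false⇒n≡0 (first≤1 t) y≡false))
                         (opposite j))
          (cong (f ∘ Fin.suc) (Fin.opposite-involutive j))

proposition4p15 : (k : ℕ) →
    ((u : Shuf k 1) → IsTri (σ̃ (proj₁ u))) ×
    ((u v : Shuf k 1) → (∀ i → σ̃ (proj₁ u) i ≡ σ̃ (proj₁ v) i) → proj₁ u ≡ proj₁ v) ×
    ((t : Tri (suc k)) → Σ (Shuf k 1) (λ u → ∀ i → σ̃ (proj₁ u) i ≡ proj₁ t i)) ×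
    ((u v : Shuf k 1) → (u ≤bub v) ⇔ (σ̃ (proj₁ u) ≤comp σ̃ (proj₁ v)))
proposition4p15 k =
  (λ u → isTri-resp (sym ∘ σ̃≗ u) (encode-isTri _ (sorted u))) ,
  (λ u v σ̃u≗σ̃v → encode-injective _ _ (sorted u) (sorted v) λ i →
     trans (sym (σ̃≗ u i)) (trans (σ̃u≗σ̃v i) (σ̃≗ v i))) ,
  (λ t → let u = fromTriword t , sorted⇒isShuf (fromTriword-sorted t) in
     u , λ i → trans (σ̃≗ u i) (encode-fromTriword t i)) ,
  λ u v → mk⇔
    (λ u≤v i → subst₂ ℕ._≤_ (sym (σ̃≗ u i)) (sym (σ̃≗ v i)) (⊑⇒encode-≤ (Star-⊑ u≤v) i))
    (λ σ̃u≤σ̃v → ⊑⇒Star (sorted u) (sorted v)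
       (encode-≤⇒⊑ λ i → subst₂ ℕ._≤_ (σ̃≗ u i) (σ̃≗ v i) (σ̃u≤σ̃v i)))
  where
  sorted : (u : Shuf k 1) → Sorted (proj₁ u)
  sorted (w , sh) = isShuf⇒sorted sh

  σ̃≗ : (u : Shuf k 1) → ∀ i → σ̃ (proj₁ u) i ≡ encode (proj₁ u) i
  σ̃≗ u = σ̃≗encode (proj₁ u) (sorted u)
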